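{- For every nonnegative integer $k$, $$(q^2-1)C_{3,3k+1}(q)=q^{3k+1}\Big(-\sum_{i=0}^k q^{ -(3i+1)}+\sum_{i=0}^k q^{3i+1}\Big),\qquad (q^2-1)C_{3,3k+2}(q)=q^{3k+2}\Big(-\sum_{i=0}^k q^{ -(3i+2)}+\sum_{i=0}^k q^{3i+2}\Big).$$ Consequently, for every positive integer $n$ coprime to $3$, the polynomial $C_{3,n}(q)$ is unimodal with respect to parity.
   Context: For a nonnegative integer $k$, $[k]=\frac{1-q^k}{1-q}$ and $[k]!=[k][k-1]\cdots[1]$ (with $[0]!=1$); $\begin{bmatrix} a+b\\ a\end{bmatrix}_q=\frac{[a+b]!}{[a]!\,[b]!}$. For positive integers $m,n$, $C_{m,n}(q)=\frac{1}{[m+n]}\begin{bmatrix} m+n\\ n\end{bmatrix}_q$; when $\gcd(m,n)=1$ this is a polynomial in $q$ with nonnegative integer coefficients. A polynomial $a_0+a_1q+\dots+a_Nq^N$ is unimodal with respect to parity if both sequences $a_0,a_2,a_4,\dots$ and $a_1,a_3,a_5,\dots$ are unimodal, where a sequence $b_0,\dots,b_s$ is unimodal if $b_0\le\cdots\le b_j\ge b_{j+1}\ge\cdots\ge b_s$ for some $j$. -}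

module Defs where

open import Data.Nat as ℕ using (ℕ; zero; suc; _∸_)
open import Data.Integer as ℤ using (ℤ; 0ℤ; 1ℤ)
open import Data.List using (List; []; _∷_; length; replicate; reverse)
open import Data.Product using (∃; _×_)
open import Relation.Binary.PropositionalEquality using (_≡_)
open import Relation.Nullary using (yes; no)

-- Polynomials in q with integer coefficients, as coefficient lists
-- a₀ ∷ a₁ ∷ … (coefficient of q^i at position i).
Poly : Set
Poly = List ℤ

coeff : Poly → ℕ → ℤ
coeff []       _       = 0ℤ
coeff (a ∷ p)  zero    = a
coeff (a ∷ p)  (suc i) = coeff p i

-- Polynomial equality: equal coefficients (ignores trailing zeros).
infix 4 _≈_
_≈_ : Poly → Poly → Set
p ≈ r = ∀ i → coeff p i ≡ coeff r i

infixl 6 _⊕_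
_⊕_ : Poly → Poly → Poly
[]      ⊕ r       = r
(a ∷ p) ⊕ []      = a ∷ p
(a ∷ p) ⊕ (b ∷ r) = (a ℤ.+ b) ∷ (p ⊕ r)

scale : ℤ → Poly → Poly
scale c []      = []
scale c (a ∷ p) = (c ℤ.* a) ∷ scale c p

neg : Poly → Poly
neg = scale (ℤ.- 1ℤ)

infixl 7 _⊗_
_⊗_ : Poly → Poly → Poly
[]      ⊗ r = []
(a ∷ p) ⊗ r = scale a r ⊕ (0ℤ ∷ (p ⊗ r))

one : Poly
one = 1ℤ ∷ []

mono : ℕ → Poly
mono zero    = one
mono (suc e) = 0ℤ ∷ mono e

sumTo : ℕ → (ℕ → Poly) → Poly
sumTo zero    f = f 0
sumTo (suc k) f = sumTo k f ⊕ f (suc k)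

-- q-integer [k] = (1 - q^k)/(1 - q) = 1 + q + … + q^{k-1}
qInt : ℕ → Poly
qInt k = replicate k 1ℤ

qFact : ℕ → Poly
qFact zero    = one
qFact (suc k) = qInt (suc k) ⊗ qFact k

-- "C_{m,n}(q) = P": P equals the rational function
--   C_{m,n}(q) = (1/[m+n]) [m+n]! / ([m]! [n]!)
-- i.e. P · [m+n] · [m]! · [n]! = [m+n]!  in ℤ[q]
-- (ℤ[q] is an integral domain, so such P is unique up to ≈).
IsC : ℕ → ℕ → Poly → Set
IsC m n P = P ⊗ (qInt (m ℕ.+ n) ⊗ (qFact m ⊗ qFact n)) ≈ qFact (m ℕ.+ n)

-- remove trailing zero coefficients (so length = degree + 1)
dropZeros : List ℤ → List ℤ
dropZeros []      = []
dropZeros (a ∷ l) with a ℤ.≟ 0ℤ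
... | yes _ = dropZeros l
... | no  _ = a ∷ l

trim : Poly → Poly
trim p = reverse (dropZeros (reverse p))

UnimodalSeq : (ℕ → ℤ) → ℕ → Set
UnimodalSeq b L =
  ∃ λ j → (∀ i → i ℕ.< j → suc i ℕ.< L → b i ℤ.≤ b (suc i))
        × (∀ i → j ℕ.≤ i → suc i ℕ.< L → b (suc i) ℤ.≤ b i)

-- a₀ + a₁q + … + a_N q^N (a_N ≠ 0) is unimodal with respect to parity:
-- a₀, a₂, a₄, … (⌈(N+1)/2⌉ terms) and a₁, a₃, … (⌊(N+1)/2⌋ terms)
-- are both unimodal.
ParityUnimodal : Poly → Set
ParityUnimodal p =
  UnimodalSeq (λ i → coeff p (2 ℕ.* i)) ((M ℕ.+ 1) ℕ./ 2)
  × UnimodalSeq (λ i → coeff p (suc (2 ℕ.* i))) (M ℕ./ 2)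
  where
  M : ℕ
  M = length (trim p)

module Submission where

-- C_{3,3k+c} is built by the recursion
--   C_{3,c} = 1 + ⋯ + q^{2(c−1)},   C_{3,n+3} = 1 + q² + q³[n+1] + q⁶C_{3,n},
-- and everything rests on the invariant [2]·C_{3,3k+c} = [3k+2c]·S₃ k, where
-- S₃ k = 1 + q³ + ⋯ + q^{3k}, proved by induction on k.  Multiplying it by [3]
-- (with [3]·S₃ k = [3k+3]) gives [2][3]C = [n+1][n+2], i.e. IsC; multiplying it
-- by q − 1 (with (q − 1)[m] = q^m − 1) gives (q² − 1)C = −S₃ k + q^{n+c}S₃ k,
-- the stated identity after reindexing both sums.  Read coefficientwise, it says
-- that C_t − C_{t+2} is ≤ 0 below degree n and ≥ 0 from degree n on, so even
-- and odd coefficients are both unimodal; every n coprime to 3 is 3k + c.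

open import Defs
open import Data.Nat using (ℕ; zero; suc; _+_; _*_; _∸_; _≤_; _<_; z≤n; s≤s)
import Data.Nat.Properties as ℕP
import Data.Nat.Tactic.RingSolver as ℕSolver
open import Data.Nat.Coprimality using (Coprime)
open import Data.Nat.Divisibility using (divides; ∣-refl)
open import Data.Nat.DivMod using (_%_; _/_; m%n<n; m≡m%n+[m/n]*n)
open import Data.Integer as ℤ using (ℤ; 0ℤ; 1ℤ)
import Data.Integer.Properties as ℤP
open import Data.List using ([]; _∷_)
open import Data.Maybe using (Maybe; just; nothing)
open import Data.Product using (∃; _×_; _,_)
open import Data.Sum using (_⊎_; inj₁; inj₂)
open import Data.Empty using (⊥-elim)
open import Function using (_∘_)
open import Relation.Nullary using (yes)
open import Relation.Binary.PropositionalEquality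
  using (_≡_; _≢_; refl; sym; trans; cong; cong₂; subst; module ≡-Reasoning)
open import Algebra.Bundles using (CommutativeRing)
open import Algebra.Properties.CommutativeSemigroup ℤP.+-commutativeSemigroup
  using (interchange; x∙yz≈y∙xz)
open import Tactic.RingSolver.Core.AlmostCommutativeRing using (AlmostCommutativeRing; fromCommutativeRing)
open import Tactic.RingSolver using (solve-∀)

-- Polynomial equality, wrapped in a record so that both sides can be
-- inferred from the type (the bare _≈_ unfolds to a Π-type).
infix 4 _≋_
record _≋_ (p r : Poly) : Set where
  constructor ≈⇒≋
  field ≋⇒≈ : p ≈ r
open _≋_ public

≋-refl : ∀ {p} → p ≋ p
≋-refl = ≈⇒≋ λ _ → refl

≋-sym : ∀ {p r} → p ≋ r → r ≋ p
≋-sym (≈⇒≋ h) = ≈⇒≋ λ i → sym (h i)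

≋-trans : ∀ {p r s} → p ≋ r → r ≋ s → p ≋ s
≋-trans (≈⇒≋ h) (≈⇒≋ g) = ≈⇒≋ λ i → trans (h i) (g i)

≡⇒≋ : ∀ {p r} → p ≡ r → p ≋ r
≡⇒≋ refl = ≋-refl

∷-cong : ∀ {a b p r} → a ≡ b → p ≋ r → (a ∷ p) ≋ (b ∷ r)
∷-cong refl (≈⇒≋ h) = ≈⇒≋ λ { zero → refl ; (suc i) → h i }

∷-head : ∀ {a b p r} → (a ∷ p) ≋ (b ∷ r) → a ≡ b
∷-head (≈⇒≋ h) = h 0

∷-tail : ∀ {a b p r} → (a ∷ p) ≋ (b ∷ r) → p ≋ r
∷-tail (≈⇒≋ h) = ≈⇒≋ λ i → h (suc i)

0∷[]≋[] : (0ℤ ∷ []) ≋ []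
0∷[]≋[] = ≈⇒≋ λ { zero → refl ; (suc i) → refl }

coeff-⊕ : ∀ p r i → coeff (p ⊕ r) i ≡ coeff p i ℤ.+ coeff r i
coeff-⊕ []      r       i       = sym (ℤP.+-identityˡ _)
coeff-⊕ (a ∷ p) []      i       = sym (ℤP.+-identityʳ _)
coeff-⊕ (a ∷ p) (b ∷ r) zero    = refl
coeff-⊕ (a ∷ p) (b ∷ r) (suc i) = coeff-⊕ p r i

coeff-scale : ∀ c p i → coeff (scale c p) i ≡ c ℤ.* coeff p i
coeff-scale c []      i       = sym (ℤP.*-zeroʳ c)
coeff-scale c (a ∷ p) zero    = refl
coeff-scale c (a ∷ p) (suc i) = coeff-scale c p i

module _ where
  open ≡-Reasoning

  ⊕-cong : ∀ {p p' r r'} → p ≋ p' → r ≋ r' → p ⊕ r ≋ p' ⊕ r'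
  ⊕-cong {p} {p'} {r} {r'} (≈⇒≋ h) (≈⇒≋ g) = ≈⇒≋ λ i → begin
    coeff (p ⊕ r) i            ≡⟨ coeff-⊕ p r i ⟩
    coeff p i ℤ.+ coeff r i    ≡⟨ cong₂ ℤ._+_ (h i) (g i) ⟩
    coeff p' i ℤ.+ coeff r' i  ≡⟨ coeff-⊕ p' r' i ⟨
    coeff (p' ⊕ r') i          ∎

  ⊕-congˡ : ∀ {p p'} r → p ≋ p' → p ⊕ r ≋ p' ⊕ r
  ⊕-congˡ r h = ⊕-cong h ≋-refl

  ⊕-congʳ : ∀ p {r r'} → r ≋ r' → p ⊕ r ≋ p ⊕ r'
  ⊕-congʳ p h = ⊕-cong ≋-refl h

  ⊕-assoc : ∀ p r s → (p ⊕ r) ⊕ s ≋ p ⊕ (r ⊕ s)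
  ⊕-assoc p r s = ≈⇒≋ λ i → begin
    coeff ((p ⊕ r) ⊕ s) i                     ≡⟨ coeff-⊕ (p ⊕ r) s i ⟩
    coeff (p ⊕ r) i ℤ.+ coeff s i             ≡⟨ cong (ℤ._+ coeff s i) (coeff-⊕ p r i) ⟩
    (coeff p i ℤ.+ coeff r i) ℤ.+ coeff s i   ≡⟨ ℤP.+-assoc (coeff p i) _ _ ⟩
    coeff p i ℤ.+ (coeff r i ℤ.+ coeff s i)   ≡⟨ cong (λ z → coeff p i ℤ.+ z) (coeff-⊕ r s i) ⟨
    coeff p i ℤ.+ coeff (r ⊕ s) i             ≡⟨ coeff-⊕ p (r ⊕ s) i ⟨
    coeff (p ⊕ (r ⊕ s)) i                     ∎

  ⊕-comm : ∀ p r → p ⊕ r ≋ r ⊕ p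
  ⊕-comm p r = ≈⇒≋ λ i → begin
    coeff (p ⊕ r) i          ≡⟨ coeff-⊕ p r i ⟩
    coeff p i ℤ.+ coeff r i  ≡⟨ ℤP.+-comm (coeff p i) _ ⟩
    coeff r i ℤ.+ coeff p i  ≡⟨ coeff-⊕ r p i ⟨
    coeff (r ⊕ p) i          ∎

  ⊕-identityʳ : ∀ p → p ⊕ [] ≋ p
  ⊕-identityʳ p = ≈⇒≋ λ i → trans (coeff-⊕ p [] i) (ℤP.+-identityʳ _)

  ⊕-inverseˡ : ∀ p → neg p ⊕ p ≋ []
  ⊕-inverseˡ p = ≈⇒≋ λ i → begin
    coeff (neg p ⊕ p) i                        ≡⟨ coeff-⊕ (neg p) p i ⟩
    coeff (neg p) i ℤ.+ coeff p i              ≡⟨ cong (ℤ._+ coeff p i) (coeff-scale (ℤ.- 1ℤ) p i) ⟩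
    ℤ.- 1ℤ ℤ.* coeff p i ℤ.+ coeff p i         ≡⟨ cong (ℤ._+ coeff p i) (ℤP.-1*i≡-i (coeff p i)) ⟩
    ℤ.- coeff p i ℤ.+ coeff p i                ≡⟨ ℤP.+-inverseˡ (coeff p i) ⟩
    0ℤ                                         ∎

  ⊕-interchange : ∀ a b c d → (a ⊕ b) ⊕ (c ⊕ d) ≋ (a ⊕ c) ⊕ (b ⊕ d)
  ⊕-interchange a b c d = ≈⇒≋ λ i → begin
    coeff ((a ⊕ b) ⊕ (c ⊕ d)) i
      ≡⟨ trans (coeff-⊕ (a ⊕ b) (c ⊕ d) i) (cong₂ ℤ._+_ (coeff-⊕ a b i) (coeff-⊕ c d i)) ⟩
    (coeff a i ℤ.+ coeff b i) ℤ.+ (coeff c i ℤ.+ coeff d i)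
      ≡⟨ interchange (coeff a i) _ _ _ ⟩
    (coeff a i ℤ.+ coeff c i) ℤ.+ (coeff b i ℤ.+ coeff d i)
      ≡⟨ trans (coeff-⊕ (a ⊕ c) (b ⊕ d) i) (cong₂ ℤ._+_ (coeff-⊕ a c i) (coeff-⊕ b d i)) ⟨
    coeff ((a ⊕ c) ⊕ (b ⊕ d)) i ∎

  scale-cong : ∀ c {p r} → p ≋ r → scale c p ≋ scale c r
  scale-cong c {p} {r} (≈⇒≋ h) = ≈⇒≋ λ i → begin
    coeff (scale c p) i   ≡⟨ coeff-scale c p i ⟩
    c ℤ.* coeff p i       ≡⟨ cong (c ℤ.*_) (h i) ⟩
    c ℤ.* coeff r i       ≡⟨ coeff-scale c r i ⟨
    coeff (scale c r) i   ∎

  scale-⊕ : ∀ c p r → scale c (p ⊕ r) ≋ scale c p ⊕ scale c r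
  scale-⊕ c p r = ≈⇒≋ λ i → begin
    coeff (scale c (p ⊕ r)) i                    ≡⟨ trans (coeff-scale c (p ⊕ r) i) (cong (c ℤ.*_) (coeff-⊕ p r i)) ⟩
    c ℤ.* (coeff p i ℤ.+ coeff r i)              ≡⟨ ℤP.*-distribˡ-+ c (coeff p i) _ ⟩
    c ℤ.* coeff p i ℤ.+ c ℤ.* coeff r i          ≡⟨ trans (coeff-⊕ (scale c p) (scale c r) i) (cong₂ ℤ._+_ (coeff-scale c p i) (coeff-scale c r i)) ⟨
    coeff (scale c p ⊕ scale c r) i              ∎

  scale-+ : ∀ a b p → scale (a ℤ.+ b) p ≋ scale a p ⊕ scale b p
  scale-+ a b p = ≈⇒≋ λ i → begin
    coeff (scale (a ℤ.+ b) p) i                  ≡⟨ coeff-scale (a ℤ.+ b) p i ⟩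
    (a ℤ.+ b) ℤ.* coeff p i                      ≡⟨ ℤP.*-distribʳ-+ (coeff p i) a b ⟩
    a ℤ.* coeff p i ℤ.+ b ℤ.* coeff p i          ≡⟨ trans (coeff-⊕ (scale a p) (scale b p) i) (cong₂ ℤ._+_ (coeff-scale a p i) (coeff-scale b p i)) ⟨
    coeff (scale a p ⊕ scale b p) i              ∎

  scale-* : ∀ a b p → scale (a ℤ.* b) p ≋ scale a (scale b p)
  scale-* a b p = ≈⇒≋ λ i → begin
    coeff (scale (a ℤ.* b) p) i       ≡⟨ coeff-scale (a ℤ.* b) p i ⟩
    a ℤ.* b ℤ.* coeff p i             ≡⟨ ℤP.*-assoc a b (coeff p i) ⟩
    a ℤ.* (b ℤ.* coeff p i)           ≡⟨ trans (coeff-scale a (scale b p) i) (cong (a ℤ.*_) (coeff-scale b p i)) ⟨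
    coeff (scale a (scale b p)) i     ∎

  scale-0 : ∀ p → scale 0ℤ p ≋ []
  scale-0 p = ≈⇒≋ λ i → trans (coeff-scale 0ℤ p i) (ℤP.*-zeroˡ (coeff p i))

  scale-1 : ∀ p → scale 1ℤ p ≋ p
  scale-1 p = ≈⇒≋ λ i → trans (coeff-scale 1ℤ p i) (ℤP.*-identityˡ (coeff p i))

  ⊕-leftComm : ∀ a b c → a ⊕ (b ⊕ c) ≋ b ⊕ (a ⊕ c)
  ⊕-leftComm a b c = ≈⇒≋ λ i → begin
    coeff (a ⊕ (b ⊕ c)) i
      ≡⟨ trans (coeff-⊕ a (b ⊕ c) i) (cong (λ z → coeff a i ℤ.+ z) (coeff-⊕ b c i)) ⟩
    coeff a i ℤ.+ (coeff b i ℤ.+ coeff c i)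
      ≡⟨ x∙yz≈y∙xz (coeff a i) (coeff b i) (coeff c i) ⟩
    coeff b i ℤ.+ (coeff a i ℤ.+ coeff c i)
      ≡⟨ trans (coeff-⊕ b (a ⊕ c) i) (cong (λ z → coeff b i ℤ.+ z) (coeff-⊕ a c i)) ⟨
    coeff (b ⊕ (a ⊕ c)) i ∎

⊗-zeroˡ : ∀ {p} r → p ≋ [] → p ⊗ r ≋ []
⊗-zeroˡ {[]}    r h = ≋-refl
⊗-zeroˡ {a ∷ p} r h =
  ⊕-cong (≋-trans (≡⇒≋ (cong (λ c → scale c r) (≋⇒≈ h 0))) (scale-0 r))
         (≋-trans (∷-cong refl (⊗-zeroˡ {p} r (≈⇒≋ λ i → ≋⇒≈ h (suc i)))) 0∷[]≋[])

⊗-zeroʳ : ∀ p → p ⊗ [] ≋ []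
⊗-zeroʳ []      = ≋-refl
⊗-zeroʳ (a ∷ p) = ≋-trans (∷-cong refl (⊗-zeroʳ p)) 0∷[]≋[]

⊗-congˡ : ∀ {p p'} r → p ≋ p' → p ⊗ r ≋ p' ⊗ r
⊗-congˡ {[]}    {[]}     r h = ≋-refl
⊗-congˡ {[]}    {b ∷ p'} r h = ≋-sym (⊗-zeroˡ r (≋-sym h))
⊗-congˡ {a ∷ p} {[]}     r h = ⊗-zeroˡ r h
⊗-congˡ {a ∷ p} {b ∷ p'} r h =
  ⊕-cong (≡⇒≋ (cong (λ c → scale c r) (∷-head h))) (∷-cong refl (⊗-congˡ r (∷-tail h)))

⊗-congʳ : ∀ p {r r'} → r ≋ r' → p ⊗ r ≋ p ⊗ r'
⊗-congʳ []      h = ≋-refl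
⊗-congʳ (a ∷ p) h = ⊕-cong (scale-cong a h) (∷-cong refl (⊗-congʳ p h))

⊗-cong : ∀ {p p' r r'} → p ≋ p' → r ≋ r' → p ⊗ r ≋ p' ⊗ r'
⊗-cong {p' = p'} {r = r} h g = ≋-trans (⊗-congˡ r h) (⊗-congʳ p' g)

⊗-distribʳ : ∀ p q r → (p ⊕ q) ⊗ r ≋ p ⊗ r ⊕ q ⊗ r
⊗-distribʳ []      q       r = ≋-refl
⊗-distribʳ (a ∷ p) []      r = ≋-sym (⊕-identityʳ _)
⊗-distribʳ (a ∷ p) (b ∷ q) r =
  ≋-trans (⊕-cong (scale-+ a b r) (∷-cong refl (⊗-distribʳ p q r)))
          (⊕-interchange (scale a r) (scale b r) (0ℤ ∷ p ⊗ r) (0ℤ ∷ q ⊗ r))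

scale-⊗ : ∀ c p r → scale c (p ⊗ r) ≋ scale c p ⊗ r
scale-⊗ c []      r = ≋-refl
scale-⊗ c (a ∷ p) r =
  ≋-trans (scale-⊕ c (scale a r) (0ℤ ∷ p ⊗ r))
          (⊕-cong (≋-sym (scale-* c a r)) (∷-cong (ℤP.*-zeroʳ c) (scale-⊗ c p r)))

0∷-⊗ : ∀ p r → (0ℤ ∷ p) ⊗ r ≋ 0ℤ ∷ p ⊗ r
0∷-⊗ p r = ⊕-congˡ (0ℤ ∷ p ⊗ r) (scale-0 r)

⊗-assoc : ∀ p q r → (p ⊗ q) ⊗ r ≋ p ⊗ (q ⊗ r)
⊗-assoc []      q r = ≋-refl
⊗-assoc (a ∷ p) q r =
  ≋-trans (⊗-distribʳ (scale a q) (0ℤ ∷ p ⊗ q) r)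
          (⊕-cong (≋-sym (scale-⊗ a q r))
                  (≋-trans (0∷-⊗ (p ⊗ q) r) (∷-cong refl (⊗-assoc p q r))))

⊗-∷ʳ : ∀ r a p → r ⊗ (a ∷ p) ≋ scale a r ⊕ (0ℤ ∷ r ⊗ p)
⊗-∷ʳ []      a p = ≋-sym 0∷[]≋[]
⊗-∷ʳ (b ∷ r) a p =
  ∷-cong (cong (ℤ._+ 0ℤ) (ℤP.*-comm b a))
         (≋-trans (⊕-congʳ (scale b p) (⊗-∷ʳ r a p)) (⊕-leftComm (scale b p) (scale a r) (0ℤ ∷ r ⊗ p)))

⊗-comm : ∀ p r → p ⊗ r ≋ r ⊗ p
⊗-comm []      r = ≋-sym (⊗-zeroʳ r)
⊗-comm (a ∷ p) r = ≋-trans (⊕-congʳ (scale a r) (∷-cong refl (⊗-comm p r))) (≋-sym (⊗-∷ʳ r a p))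

⊗-identityˡ : ∀ p → one ⊗ p ≋ p
⊗-identityˡ p = ≋-trans (⊕-cong (scale-1 p) 0∷[]≋[]) (⊕-identityʳ p)

⊗-distribˡ : ∀ p q r → p ⊗ (q ⊕ r) ≋ p ⊗ q ⊕ p ⊗ r
⊗-distribˡ p q r = ≋-trans (⊗-comm p (q ⊕ r)) (≋-trans (⊗-distribʳ q r p) (⊕-cong (⊗-comm q p) (⊗-comm r p)))

neg-cong : ∀ {p r} → p ≋ r → neg p ≋ neg r
neg-cong = scale-cong (ℤ.- 1ℤ)

polyRing : CommutativeRing _ _
polyRing = record
  { Carrier = Poly ; _≈_ = _≋_ ; _+_ = _⊕_ ; _*_ = _⊗_ ; -_ = neg ; 0# = [] ; 1# = one
  ; isCommutativeRing = record
    { isRing = record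
      { +-isAbelianGroup = record
        { isGroup = record
          { isMonoid = record
            { isSemigroup = record
              { isMagma = record
                { isEquivalence = record { refl = ≋-refl ; sym = ≋-sym ; trans = ≋-trans }
                ; ∙-cong = ⊕-cong }
              ; assoc = ⊕-assoc }
            ; identity = (λ p → ≋-refl) , ⊕-identityʳ }
          ; inverse = ⊕-inverseˡ , (λ p → ≋-trans (⊕-comm p (neg p)) (⊕-inverseˡ p))
          ; ⁻¹-cong = neg-cong }
        ; comm = ⊕-comm }
      ; *-cong = ⊗-cong
      ; *-assoc = ⊗-assoc
      ; *-identity = ⊗-identityˡ , (λ p → ≋-trans (⊗-comm p one) (⊗-identityˡ p))
      ; distrib = ⊗-distribˡ , (λ p q r → ⊗-distribʳ q r p) }
    ; *-comm = ⊗-comm } }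

-- Decide whether a polynomial is zero; the reflective ring solver uses this
-- to discard vanishing coefficients.
≟[] : ∀ p → Maybe ([] ≋ p)
≟[] []      = just ≋-refl
≟[] (a ∷ p) with a ℤ.≟ 0ℤ | ≟[] p
... | yes refl | just z = just (≋-trans (≋-sym 0∷[]≋[]) (∷-cong refl z))
... | _        | _      = nothing

polyACR : AlmostCommutativeRing _ _
polyACR = fromCommutativeRing polyRing ≟[]

open import Relation.Binary.Reasoning.Setoid (CommutativeRing.setoid polyRing)

open AlmostCommutativeRing polyACR using (_^_)

q : Poly
q = mono 1

q⊗ : ∀ p → q ⊗ p ≋ 0ℤ ∷ p
q⊗ p = ≋-trans (0∷-⊗ one p) (∷-cong refl (⊗-identityˡ p))

mono-+ : ∀ a b → mono (a + b) ≋ mono a ⊗ mono b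
mono-+ zero    b = ≋-sym (⊗-identityˡ (mono b))
mono-+ (suc a) b = ≋-trans (∷-cong refl (mono-+ a b)) (≋-sym (0∷-⊗ (mono a) (mono b)))

-- mono n agrees with the ring-theoretic power q ^ n used by the solver
mono≋q^ : ∀ n → mono n ≋ q ^ n
mono≋q^ zero          = ≋-refl
mono≋q^ (suc zero)    = ≋-refl
mono≋q^ (suc (suc n)) =
  ≋-trans (≋-sym (q⊗ (mono (suc n)))) (≋-trans (⊗-congʳ q (mono≋q^ (suc n))) (⊗-comm q (q ^ suc n)))

qInt-+ : ∀ a b → qInt (a + b) ≋ qInt a ⊕ mono a ⊗ qInt b
qInt-+ zero    b = ≋-sym (⊗-identityˡ (qInt b))
qInt-+ (suc a) b =
  ≋-trans (∷-cong refl (qInt-+ a b)) (⊕-congʳ (1ℤ ∷ qInt a) (≋-sym (0∷-⊗ (mono a) (qInt b))))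

telescope : ∀ m → (q ⊕ neg one) ⊗ qInt m ≋ mono m ⊕ neg one
telescope zero    = ≈⇒≋ λ { zero → refl ; (suc zero) → refl ; (suc (suc i)) → refl }
telescope (suc m) = begin
  (q ⊕ neg one) ⊗ qInt (1 + m)                    ≈⟨ ⊗-congʳ (q ⊕ neg one) (qInt-+ 1 m) ⟩
  (q ⊕ neg one) ⊗ (one ⊕ q ⊗ qInt m)              ≈⟨ expand q (qInt m) ⟩
  (q ⊕ neg one) ⊕ q ⊗ ((q ⊕ neg one) ⊗ qInt m)    ≈⟨ ⊕-congʳ (q ⊕ neg one) (⊗-congʳ q (telescope m)) ⟩
  (q ⊕ neg one) ⊕ q ⊗ (mono m ⊕ neg one)          ≈⟨ collapse q (mono m) ⟩
  q ⊗ mono m ⊕ neg one                            ≈⟨ ⊕-congˡ (neg one) (q⊗ (mono m)) ⟩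
  mono (1 + m) ⊕ neg one                          ∎
  where
  expand : ∀ x I → (x ⊕ neg one) ⊗ (one ⊕ x ⊗ I) ≋ (x ⊕ neg one) ⊕ x ⊗ ((x ⊕ neg one) ⊗ I)
  expand = solve-∀ polyACR
  collapse : ∀ x Q → (x ⊕ neg one) ⊕ x ⊗ (Q ⊕ neg one) ≋ x ⊗ Q ⊕ neg one
  collapse = solve-∀ polyACR

qInt-consecutive : ∀ m → qInt (suc m) ⊕ qInt (suc (suc m)) ≋ one ⊕ qInt 2 ⊗ qInt (suc m)
qInt-consecutive m = begin
  qInt (suc m) ⊕ qInt (1 + suc m)            ≈⟨ ⊕-congʳ (qInt (suc m)) (qInt-+ 1 (suc m)) ⟩
  qInt (suc m) ⊕ (one ⊕ q ⊗ qInt (suc m))    ≈⟨ regroup q (qInt (suc m)) ⟩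
  one ⊕ qInt 2 ⊗ qInt (suc m)                ∎
  where
  regroup : ∀ x I → I ⊕ (one ⊕ x ⊗ I) ≋ one ⊕ (one ⊕ x) ⊗ I
  regroup = solve-∀ polyACR

sumTo-cong : ∀ k {f g : ℕ → Poly} → (∀ i → i ≤ k → f i ≋ g i) → sumTo k f ≋ sumTo k g
sumTo-cong zero    h = h 0 z≤n
sumTo-cong (suc k) h = ⊕-cong (sumTo-cong k λ i i≤k → h i (ℕP.m≤n⇒m≤1+n i≤k)) (h (suc k) ℕP.≤-refl)

sumTo-⊗ : ∀ k c f → c ⊗ sumTo k f ≋ sumTo k (λ i → c ⊗ f i)
sumTo-⊗ zero    c f = ≋-refl
sumTo-⊗ (suc k) c f = ≋-trans (⊗-distribˡ c (sumTo k f) (f (suc k))) (⊕-congˡ (c ⊗ f (suc k)) (sumTo-⊗ k c f))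

sumTo-peel : ∀ k f → sumTo (suc k) f ≋ f 0 ⊕ sumTo k (f ∘ suc)
sumTo-peel zero    f = ≋-refl
sumTo-peel (suc k) f =
  ≋-trans (⊕-congˡ (f (suc (suc k))) (sumTo-peel k f)) (⊕-assoc (f 0) (sumTo k (f ∘ suc)) (f (suc (suc k))))

sumTo-reverse : ∀ k f → sumTo k (λ i → f (k ∸ i)) ≋ sumTo k f
sumTo-reverse zero    f = ≋-refl
sumTo-reverse (suc k) f = begin
  sumTo k (λ i → f (suc k ∸ i)) ⊕ f (k ∸ k)    ≈⟨ ⊕-cong (sumTo-cong k λ i i≤k → ≡⇒≋ (cong f (ℕP.+-∸-assoc 1 i≤k)))
                                                         (≡⇒≋ (cong f (ℕP.n∸n≡0 k))) ⟩
  sumTo k (λ i → f (suc (k ∸ i))) ⊕ f 0        ≈⟨ ⊕-congˡ (f 0) (sumTo-reverse k (f ∘ suc)) ⟩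
  sumTo k (f ∘ suc) ⊕ f 0                      ≈⟨ ⊕-comm (sumTo k (f ∘ suc)) (f 0) ⟩
  f 0 ⊕ sumTo k (f ∘ suc)                      ≈⟨ sumTo-peel k f ⟨
  sumTo (suc k) f                              ∎

geometric : ∀ m k → qInt m ⊗ sumTo k (λ i → mono (m * i)) ≋ qInt (m * suc k)
geometric m zero    = begin
  qInt m ⊗ mono (m * 0)  ≈⟨ ⊗-congʳ (qInt m) (≡⇒≋ (cong mono (ℕP.*-zeroʳ m))) ⟩
  qInt m ⊗ one           ≈⟨ ⊗-comm (qInt m) one ⟩
  one ⊗ qInt m           ≈⟨ ⊗-identityˡ (qInt m) ⟩
  qInt m                 ≈⟨ ≡⇒≋ (cong qInt (ℕP.*-identityʳ m)) ⟨
  qInt (m * 1)           ∎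
geometric m (suc k) = begin
  qInt m ⊗ (sumTo k f ⊕ mono M)                 ≈⟨ ⊗-distribˡ (qInt m) (sumTo k f) (mono M) ⟩
  qInt m ⊗ sumTo k f ⊕ qInt m ⊗ mono M          ≈⟨ ⊕-cong (geometric m k) (⊗-comm (qInt m) (mono M)) ⟩
  qInt M ⊕ mono M ⊗ qInt m                      ≈⟨ qInt-+ M m ⟨
  qInt (M + m)                                  ≈⟨ ≡⇒≋ (cong qInt (trans (ℕP.+-comm M m) (sym (ℕP.*-suc m (suc k))))) ⟩
  qInt (m * suc (suc k))                        ∎
  where
  f : ℕ → Poly
  f i = mono (m * i)
  M : ℕ
  M = m * suc k

S₃ : ℕ → Poly
S₃ k = sumTo k (λ i → mono (3 * i))

S₃-suc : ∀ k → S₃ (suc k) ≋ one ⊕ q ^ 3 ⊗ S₃ k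
S₃-suc k = begin
  S₃ (suc k)                                   ≈⟨ sumTo-peel k (λ i → mono (3 * i)) ⟩
  one ⊕ sumTo k (λ i → mono (3 * suc i))       ≈⟨ ⊕-congʳ one (sumTo-cong k λ i _ → mono-3+ i) ⟩
  one ⊕ sumTo k (λ i → mono 3 ⊗ mono (3 * i))  ≈⟨ ⊕-congʳ one (sumTo-⊗ k (mono 3) (λ i → mono (3 * i))) ⟨
  one ⊕ mono 3 ⊗ S₃ k                          ≈⟨ ⊕-congʳ one (⊗-congˡ (S₃ k) (mono≋q^ 3)) ⟩
  one ⊕ q ^ 3 ⊗ S₃ k                           ∎
  where
  mono-3+ : ∀ i → mono (3 * suc i) ≋ mono 3 ⊗ mono (3 * i)
  mono-3+ i = ≋-trans (≡⇒≋ (cong mono (ℕP.*-suc 3 i))) (mono-+ 3 (3 * i))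

-- The sum Σ_{i ≤ k} q^{n - (3i+c)} of the theorem (n = 3k + c) is S₃ k, read backwards.
S₃-reversed : ∀ k c → sumTo k (λ i → mono ((3 * k + c) ∸ (3 * i + c))) ≋ S₃ k
S₃-reversed k c = ≋-trans (sumTo-cong k λ i _ → ≡⇒≋ (cong mono (exponent i))) (sumTo-reverse k (λ i → mono (3 * i)))
  where
  exponent : ∀ i → (3 * k + c) ∸ (3 * i + c) ≡ 3 * (k ∸ i)
  exponent i = trans (cong₂ _∸_ (ℕP.+-comm (3 * k) c) (ℕP.+-comm (3 * i) c))
               (trans (ℕP.[m+n]∸[m+o]≡n∸o c (3 * k) (3 * i)) (sym (ℕP.*-distribˡ-∸ 3 k i)))

S₃-shifted : ∀ k c → sumTo k (λ i → mono ((3 * k + c) + (3 * i + c))) ≋ mono (3 * k + c + c) ⊗ S₃ k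
S₃-shifted k c = begin
  sumTo k (λ i → mono (n + (3 * i + c)))          ≈⟨ sumTo-cong k (λ i _ → ≋-trans (≡⇒≋ (cong mono (exponent i))) (mono-+ (n + c) (3 * i))) ⟩
  sumTo k (λ i → mono (n + c) ⊗ mono (3 * i))     ≈⟨ sumTo-⊗ k (mono (n + c)) (λ i → mono (3 * i)) ⟨
  mono (n + c) ⊗ S₃ k                             ∎
  where
  n : ℕ
  n = 3 * k + c
  exponent : ∀ i → n + (3 * i + c) ≡ (n + c) + 3 * i
  exponent i = trans (cong (n +_) (ℕP.+-comm (3 * i) c)) (sym (ℕP.+-assoc n c (3 * i)))

-- C₃ c k is C_{3,3k+c}(q) for c ∈ {1, 2}: C_{3,1} = 1, C_{3,2} = 1 + q², and
-- C_{3,n+3} = 1 + q² + q³[n+1] + q⁶ C_{3,n}.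
C₃ : ℕ → ℕ → Poly
C₃ c zero    = sumTo (c ∸ 1) (λ j → mono (2 * j))
C₃ c (suc k) = one ⊕ q ^ 2 ⊕ q ^ 3 ⊗ qInt (suc (3 * k + c)) ⊕ q ^ 6 ⊗ C₃ c k

recursion-step : ∀ {C S M a b} →
  qInt 2 ⊗ C ≋ a ⊗ S → qInt 3 ⊗ S ≋ b → a ⊕ b ≋ one ⊕ qInt 2 ⊗ M →
  qInt 2 ⊗ (one ⊕ q ^ 2 ⊕ q ^ 3 ⊗ M ⊕ q ^ 6 ⊗ C) ≋ (qInt 3 ⊕ q ^ 3 ⊗ a) ⊗ (one ⊕ q ^ 3 ⊗ S)
recursion-step {C} {S} {M} {a} {b} hC hS hM = begin
  qInt 2 ⊗ (one ⊕ q ^ 2 ⊕ q ^ 3 ⊗ M ⊕ q ^ 6 ⊗ C)                ≈⟨ expand q M C ⟩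
  qInt 3 ⊕ q ^ 3 ⊗ (one ⊕ qInt 2 ⊗ M) ⊕ q ^ 6 ⊗ (qInt 2 ⊗ C)    ≈⟨ ⊕-cong (⊕-congʳ (qInt 3) (⊗-congʳ (q ^ 3) (≋-sym hM)))
                                                                            (⊗-congʳ (q ^ 6) hC) ⟩
  qInt 3 ⊕ q ^ 3 ⊗ (a ⊕ b) ⊕ q ^ 6 ⊗ (a ⊗ S)                    ≈⟨ ⊕-congˡ (q ^ 6 ⊗ (a ⊗ S))
                                                                       (⊕-congʳ (qInt 3) (⊗-congʳ (q ^ 3) (⊕-congʳ a (≋-sym hS)))) ⟩
  qInt 3 ⊕ q ^ 3 ⊗ (a ⊕ qInt 3 ⊗ S) ⊕ q ^ 6 ⊗ (a ⊗ S)           ≈⟨ factor q a S ⟩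
  (qInt 3 ⊕ q ^ 3 ⊗ a) ⊗ (one ⊕ q ^ 3 ⊗ S)                       ∎
  where
  expand : ∀ x M C → (one ⊕ x) ⊗ (one ⊕ x ^ 2 ⊕ x ^ 3 ⊗ M ⊕ x ^ 6 ⊗ C)
                   ≋ (one ⊕ x ⊕ x ^ 2) ⊕ x ^ 3 ⊗ (one ⊕ (one ⊕ x) ⊗ M) ⊕ x ^ 6 ⊗ ((one ⊕ x) ⊗ C)
  expand = solve-∀ polyACR
  factor : ∀ x a S → (one ⊕ x ⊕ x ^ 2) ⊕ x ^ 3 ⊗ (a ⊕ (one ⊕ x ⊕ x ^ 2) ⊗ S) ⊕ x ^ 6 ⊗ (a ⊗ S)
                   ≋ ((one ⊕ x ⊕ x ^ 2) ⊕ x ^ 3 ⊗ a) ⊗ (one ⊕ x ^ 3 ⊗ S)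
  factor = solve-∀ polyACR

-- For c ∈ {1, 2} and n = 3k + c, the numbers 3k + 2c and 3(k+1) are n+1 and
-- n+2 in some order; so a symmetric expression in [3k+2c], [3(k+1)] is the
-- same expression in [n+1], [n+2].
symmetric-pair : ∀ k {c} → c ≡ 1 ⊎ c ≡ 2 → (_∙_ : Poly → Poly → Poly) → (∀ u v → u ∙ v ≋ v ∙ u) →
  qInt (3 * k + c + c) ∙ qInt (3 * suc k) ≋ qInt (suc (3 * k + c)) ∙ qInt (suc (suc (3 * k + c)))
symmetric-pair k (inj₁ refl) _∙_ _ = ≡⇒≋ (cong₂ (λ a b → qInt a ∙ qInt b) (e₁ k) (e₂ k))
  where
  e₁ : ∀ k → 3 * k + 1 + 1 ≡ suc (3 * k + 1)
  e₁ = ℕSolver.solve-∀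
  e₂ : ∀ k → 3 * suc k ≡ suc (suc (3 * k + 1))
  e₂ = ℕSolver.solve-∀
symmetric-pair k (inj₂ refl) _∙_ ∙-comm =
  ≋-trans (∙-comm (qInt (3 * k + 2 + 2)) (qInt (3 * suc k))) (≡⇒≋ (cong₂ (λ a b → qInt a ∙ qInt b) (e₁ k) (e₂ k)))
  where
  e₁ : ∀ k → 3 * suc k ≡ suc (3 * k + 2)
  e₁ = ℕSolver.solve-∀
  e₂ : ∀ k → 3 * k + 2 + 2 ≡ suc (suc (3 * k + 2))
  e₂ = ℕSolver.solve-∀

invariant : ∀ {c} → c ≡ 1 ⊎ c ≡ 2 → ∀ k → qInt 2 ⊗ C₃ c k ≋ qInt (3 * k + c + c) ⊗ S₃ k
invariant {c} r zero    = ≋-trans (base r) (⊗-comm one (qInt (c + c)))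
  where
  base : ∀ {c} → c ≡ 1 ⊎ c ≡ 2 → qInt 2 ⊗ C₃ c 0 ≋ one ⊗ qInt (c + c)
  base (inj₁ refl) = ≋-trans (geometric 2 0) (≋-sym (⊗-identityˡ (qInt 2)))
  base (inj₂ refl) = ≋-trans (geometric 2 1) (≋-sym (⊗-identityˡ (qInt 4)))
invariant {c} r (suc k) = begin
  qInt 2 ⊗ C₃ c (suc k)                           ≈⟨ recursion-step {M = qInt (suc (3 * k + c))} (invariant r k) (geometric 3 k) consecutive ⟩
  (qInt 3 ⊕ q ^ 3 ⊗ qInt N) ⊗ (one ⊕ q ^ 3 ⊗ S₃ k)  ≈⟨ ⊗-cong (≋-sym [3+N]) (≋-sym (S₃-suc k)) ⟩
  qInt (3 + N) ⊗ S₃ (suc k)                        ≈⟨ ≡⇒≋ (cong (λ m → qInt m ⊗ S₃ (suc k)) (e k c)) ⟩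
  qInt (3 * suc k + c + c) ⊗ S₃ (suc k)            ∎
  where
  N : ℕ
  N = 3 * k + c + c
  consecutive : qInt N ⊕ qInt (3 * suc k) ≋ one ⊕ qInt 2 ⊗ qInt (suc (3 * k + c))
  consecutive = ≋-trans (symmetric-pair k r _⊕_ ⊕-comm) (qInt-consecutive (3 * k + c))
  [3+N] : qInt (3 + N) ≋ qInt 3 ⊕ q ^ 3 ⊗ qInt N
  [3+N] = ≋-trans (qInt-+ 3 N) (⊕-congʳ (qInt 3) (⊗-congˡ (qInt N) (mono≋q^ 3)))
  e : ∀ k c → 3 + (3 * k + c + c) ≡ 3 * suc k + c + c
  e = ℕSolver.solve-∀

-- Since C_{3,n} = [n+1][n+2]/([2][3]), the defining equation of IsC 3 n P
-- follows from [2][3]P = [n+1][n+2].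
isC-from : ∀ n P → qInt 2 ⊗ (qInt 3 ⊗ P) ≋ qInt (suc n) ⊗ qInt (suc (suc n)) → IsC 3 n P
isC-from n P h = ≋⇒≈ (begin
  P ⊗ (qInt (3 + n) ⊗ (qFact 3 ⊗ qFact n))                               ≈⟨ regroup (qInt 2) (qInt 3) P (qInt (3 + n)) (qFact n) ⟩
  qInt (3 + n) ⊗ ((qInt 2 ⊗ (qInt 3 ⊗ P)) ⊗ qFact n)                      ≈⟨ ⊗-congʳ (qInt (3 + n)) (⊗-congˡ (qFact n) h) ⟩
  qInt (3 + n) ⊗ ((qInt (suc n) ⊗ qInt (suc (suc n))) ⊗ qFact n)          ≈⟨ reorder (qInt (3 + n)) (qInt (suc n)) (qInt (suc (suc n))) (qFact n) ⟩
  qFact (3 + n)                                                          ∎)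
  where
  regroup : ∀ t₂ t₃ P I F → P ⊗ (I ⊗ ((t₃ ⊗ (t₂ ⊗ (one ⊗ one))) ⊗ F)) ≋ I ⊗ ((t₂ ⊗ (t₃ ⊗ P)) ⊗ F)
  regroup = solve-∀ polyACR
  reorder : ∀ I a b F → I ⊗ ((a ⊗ b) ⊗ F) ≋ I ⊗ (b ⊗ (a ⊗ F))
  reorder = solve-∀ polyACR

C₃-isC : ∀ {c} → c ≡ 1 ⊎ c ≡ 2 → ∀ k → IsC 3 (3 * k + c) (C₃ c k)
C₃-isC {c} r k = isC-from (3 * k + c) (C₃ c k) (begin
  qInt 2 ⊗ (qInt 3 ⊗ C₃ c k)            ≈⟨ ⊗-leftComm (qInt 2) (qInt 3) (C₃ c k) ⟩
  qInt 3 ⊗ (qInt 2 ⊗ C₃ c k)            ≈⟨ ⊗-congʳ (qInt 3) (invariant r k) ⟩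
  qInt 3 ⊗ (qInt N ⊗ S₃ k)              ≈⟨ ⊗-leftComm (qInt 3) (qInt N) (S₃ k) ⟩
  qInt N ⊗ (qInt 3 ⊗ S₃ k)              ≈⟨ ⊗-congʳ (qInt N) (geometric 3 k) ⟩
  qInt N ⊗ qInt (3 * suc k)             ≈⟨ symmetric-pair k r _⊗_ ⊗-comm ⟩
  qInt (suc (3 * k + c)) ⊗ qInt (suc (suc (3 * k + c))) ∎)
  where
  N : ℕ
  N = 3 * k + c + c
  ⊗-leftComm : ∀ a b c → a ⊗ (b ⊗ c) ≋ b ⊗ (a ⊗ c)
  ⊗-leftComm = solve-∀ polyACR

C₃-difference : ∀ {c} → c ≡ 1 ⊎ c ≡ 2 → ∀ k →
  (mono 2 ⊕ neg one) ⊗ C₃ c k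
    ≋ neg (sumTo k (λ i → mono ((3 * k + c) ∸ (3 * i + c)))) ⊕ sumTo k (λ i → mono ((3 * k + c) + (3 * i + c)))
C₃-difference {c} r k = begin
  (mono 2 ⊕ neg one) ⊗ C₃ c k            ≈⟨ ⊗-congˡ (C₃ c k) (≋-sym (telescope 2)) ⟩
  ((q ⊕ neg one) ⊗ qInt 2) ⊗ C₃ c k      ≈⟨ ⊗-assoc (q ⊕ neg one) (qInt 2) (C₃ c k) ⟩
  (q ⊕ neg one) ⊗ (qInt 2 ⊗ C₃ c k)      ≈⟨ ⊗-congʳ (q ⊕ neg one) (invariant r k) ⟩
  (q ⊕ neg one) ⊗ (qInt N ⊗ S₃ k)        ≈⟨ ⊗-assoc (q ⊕ neg one) (qInt N) (S₃ k) ⟨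
  ((q ⊕ neg one) ⊗ qInt N) ⊗ S₃ k        ≈⟨ ⊗-congˡ (S₃ k) (telescope N) ⟩
  (mono N ⊕ neg one) ⊗ S₃ k              ≈⟨ distribute (mono N) (S₃ k) ⟩
  neg (S₃ k) ⊕ mono N ⊗ S₃ k             ≈⟨ ⊕-cong (neg-cong (S₃-reversed k c)) (S₃-shifted k c) ⟨
  neg (sumTo k (λ i → mono ((3 * k + c) ∸ (3 * i + c)))) ⊕ sumTo k (λ i → mono ((3 * k + c) + (3 * i + c))) ∎
  where
  N : ℕ
  N = 3 * k + c + c
  distribute : ∀ M S → (M ⊕ neg one) ⊗ S ≋ neg S ⊕ M ⊗ S
  distribute = solve-∀ polyACR

Nonneg : Poly → Set
Nonneg p = ∀ i → 0ℤ ℤ.≤ coeff p i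

⊕-nonneg : ∀ {p r} → Nonneg p → Nonneg r → Nonneg (p ⊕ r)
⊕-nonneg {p} {r} hp hr i = subst (0ℤ ℤ.≤_) (sym (coeff-⊕ p r i)) (ℤP.+-mono-≤ (hp i) (hr i))

mono-nonneg : ∀ e → Nonneg (mono e)
mono-nonneg zero    zero    = ℤ.+≤+ z≤n
mono-nonneg zero    (suc i) = ℤ.+≤+ z≤n
mono-nonneg (suc e) zero    = ℤ.+≤+ z≤n
mono-nonneg (suc e) (suc i) = mono-nonneg e i

mono-vanishes : ∀ e j → e ≢ j → coeff (mono e) j ≡ 0ℤ
mono-vanishes zero    zero    e≢j = ⊥-elim (e≢j refl)
mono-vanishes zero    (suc j) e≢j = refl
mono-vanishes (suc e) zero    e≢j = refl
mono-vanishes (suc e) (suc j) e≢j = mono-vanishes e j (e≢j ∘ cong suc)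

sumTo-nonneg : ∀ k {f} → (∀ i → Nonneg (f i)) → Nonneg (sumTo k f)
sumTo-nonneg zero    h = h 0
sumTo-nonneg (suc k) {f} h = ⊕-nonneg {sumTo k f} (sumTo-nonneg k h) (h (suc k))

sumTo-vanishes : ∀ k {f} j → (∀ i → coeff (f i) j ≡ 0ℤ) → coeff (sumTo k f) j ≡ 0ℤ
sumTo-vanishes zero    j h = h 0
sumTo-vanishes (suc k) {f} j h =
  trans (coeff-⊕ (sumTo k f) (f (suc k)) j) (cong₂ ℤ._+_ (sumTo-vanishes k j h) (h (suc k)))

coeff-q²-1 : ∀ P t → coeff ((mono 2 ⊕ neg one) ⊗ P) (2 + t) ≡ coeff P t ℤ.- coeff P (2 + t)
coeff-q²-1 P t =
  trans (≋⇒≈ split (2 + t))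
        (trans (coeff-⊕ (0ℤ ∷ 0ℤ ∷ P) (neg P) (2 + t))
               (cong (λ z → coeff P t ℤ.+ z) (trans (coeff-scale (ℤ.- 1ℤ) P (2 + t)) (ℤP.-1*i≡-i _))))
  where
  split : (mono 2 ⊕ neg one) ⊗ P ≋ (0ℤ ∷ 0ℤ ∷ P) ⊕ neg P
  split = ≋-trans (⊗-distribʳ (mono 2) (neg one) P)
                  (⊕-cong (≋-trans (0∷-⊗ (mono 1) P) (∷-cong refl (q⊗ P)))
                          (≋-trans (≋-sym (scale-⊗ (ℤ.- 1ℤ) one P)) (scale-cong (ℤ.- 1ℤ) (⊗-identityˡ P))))

PeakedAt : ℕ → (ℕ → ℤ) → Set
PeakedAt n a = (∀ t → 2 + t ≤ n → a t ℤ.≤ a (2 + t)) × (∀ t → n ≤ 2 + t → a (2 + t) ℤ.≤ a t)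

peaked : ∀ n P A B → (mono 2 ⊕ neg one) ⊗ P ≋ neg A ⊕ B → Nonneg A → Nonneg B →
  (∀ j → n ≤ j → coeff A j ≡ 0ℤ) → (∀ j → j ≤ n → coeff B j ≡ 0ℤ) → PeakedAt n (coeff P)
peaked n P A B eq A≥0 B≥0 A-low B-high = rises , falls
  where
  difference : ∀ t → coeff P t ℤ.- coeff P (2 + t) ≡ ℤ.- coeff A (2 + t) ℤ.+ coeff B (2 + t)
  difference t = trans (sym (coeff-q²-1 P t))
    (trans (≋⇒≈ eq (2 + t))
      (trans (coeff-⊕ (neg A) B (2 + t)) (cong (ℤ._+ coeff B (2 + t)) (trans (coeff-scale (ℤ.- 1ℤ) A (2 + t)) (ℤP.-1*i≡-i _)))))
  -- up to degree n only A contributes, from degree n on only B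
  below-peak : ∀ t → 2 + t ≤ n → coeff P t ℤ.- coeff P (2 + t) ≡ ℤ.- coeff A (2 + t)
  below-peak t t+2≤n =
    trans (difference t) (trans (cong (λ z → ℤ.- coeff A (2 + t) ℤ.+ z) (B-high (2 + t) t+2≤n)) (ℤP.+-identityʳ _))
  above-peak : ∀ t → n ≤ 2 + t → coeff P t ℤ.- coeff P (2 + t) ≡ coeff B (2 + t)
  above-peak t n≤t+2 =
    trans (difference t) (trans (cong (λ z → ℤ.- z ℤ.+ coeff B (2 + t)) (A-low (2 + t) n≤t+2)) (ℤP.+-identityˡ _))
  rises : ∀ t → 2 + t ≤ n → coeff P t ℤ.≤ coeff P (2 + t)
  rises t t+2≤n = ℤP.i-j≤0⇒i≤j (subst (ℤ._≤ 0ℤ) (sym (below-peak t t+2≤n)) (ℤP.neg-mono-≤ (A≥0 (2 + t))))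
  falls : ∀ t → n ≤ 2 + t → coeff P (2 + t) ℤ.≤ coeff P t
  falls t n≤t+2 = ℤP.0≤i-j⇒j≤i (subst (0ℤ ℤ.≤_) (sym (above-peak t n≤t+2)) (B≥0 (2 + t)))

turning-point : ∀ n → ∃ λ j → (∀ i → i < j → 2 + 2 * i ≤ n) × (∀ i → j ≤ i → n ≤ 2 + 2 * i)
turning-point zero          = 0 , (λ i ()) , (λ i _ → z≤n)
turning-point (suc zero)    = 0 , (λ i ()) , (λ i _ → s≤s z≤n)
turning-point (suc (suc n)) with turning-point n
... | j , below , above = suc j , below′ , above′
  where
  below′ : ∀ i → i < suc j → 2 + 2 * i ≤ 2 + n
  below′ zero    _         = s≤s (s≤s z≤n)
  below′ (suc i) (s≤s i<j) = subst (_≤ 2 + n) (cong (2 +_) (sym (ℕP.*-suc 2 i))) (s≤s (s≤s (below i i<j)))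
  above′ : ∀ i → suc j ≤ i → 2 + n ≤ 2 + 2 * i
  above′ (suc i) (s≤s j≤i) = subst (2 + n ≤_) (cong (2 +_) (sym (ℕP.*-suc 2 i))) (s≤s (s≤s (above i j≤i)))

even-unimodal : ∀ n a → PeakedAt n a → ∀ L → UnimodalSeq (λ i → a (2 * i)) L
even-unimodal n a (rises , falls) L with turning-point n
... | j , below , above =
  j , (λ i i<j _ → subst (λ m → a (2 * i) ℤ.≤ a m) (sym (ℕP.*-suc 2 i)) (rises (2 * i) (below i i<j)))
    , (λ i j≤i _ → subst (λ m → a m ℤ.≤ a (2 * i)) (sym (ℕP.*-suc 2 i)) (falls (2 * i) (above i j≤i)))

peaked-suc : ∀ n a → PeakedAt n a → PeakedAt (n ∸ 1) (a ∘ suc)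
peaked-suc zero    a (rises , falls) = (λ t ()) , (λ t _ → falls (suc t) z≤n)
peaked-suc (suc n) a (rises , falls) = (λ t le → rises (suc t) (s≤s le)) , (λ t le → falls (suc t) (s≤s le))

-- the even coefficients peak at n, the odd ones (shifted down by one) at n - 1
peaked⇒parityUnimodal : ∀ n P → PeakedAt n (coeff P) → ParityUnimodal P
peaked⇒parityUnimodal n P peak =
  even-unimodal n (coeff P) peak _ , even-unimodal (n ∸ 1) (coeff P ∘ suc) (peaked-suc n (coeff P) peak) _

residue-pos : ∀ {c} → c ≡ 1 ⊎ c ≡ 2 → 0 < c
residue-pos (inj₁ refl) = s≤s z≤n
residue-pos (inj₂ refl) = s≤s z≤n

∸-< : ∀ {n m} → 0 < n → 0 < m → n ∸ m < n
∸-< {suc n} {suc m} _ _ = s≤s (ℕP.m∸n≤m n m)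

C₃-parityUnimodal : ∀ {c} → c ≡ 1 ⊎ c ≡ 2 → ∀ k → ParityUnimodal (C₃ c k)
C₃-parityUnimodal {c} r k =
  peaked⇒parityUnimodal n (C₃ c k)
    (peaked n (C₃ c k) (sumTo k (mono ∘ below)) (sumTo k (mono ∘ above)) (C₃-difference r k)
            (sumTo-nonneg k λ i → mono-nonneg (below i)) (sumTo-nonneg k λ i → mono-nonneg (above i))
            (λ j n≤j → sumTo-vanishes k j λ i → mono-vanishes (below i) j λ eq →
               ℕP.<⇒≢ (ℕP.<-≤-trans (below<n i) n≤j) eq)
            (λ j j≤n → sumTo-vanishes k j λ i → mono-vanishes (above i) j λ eq →
               ℕP.<⇒≢ (ℕP.≤-<-trans j≤n (ℕP.m<m+n n (step>0 i))) (sym eq)))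
  where
  n : ℕ
  n = 3 * k + c
  below above : ℕ → ℕ
  below i = n ∸ (3 * i + c)
  above i = n + (3 * i + c)
  step>0 : ∀ i → 0 < 3 * i + c
  step>0 i = ℕP.≤-trans (residue-pos r) (ℕP.m≤n+m c (3 * i))
  below<n : ∀ i → below i < n
  below<n i = ∸-< (step>0 k) (step>0 i)

-- the form of n = n % 3 + (n / 3) * 3 used below
residue-form : ∀ k c → 3 * k + c ≡ c + k * 3
residue-form = ℕSolver.solve-∀

coprime-to-3 : ∀ n → Coprime 3 n → ∃ λ k → ∃ λ c → (c ≡ 1 ⊎ c ≡ 2) × 3 * k + c ≡ n
coprime-to-3 n cop with n % 3 | m%n<n n 3 | m≡m%n+[m/n]*n n 3
... | 0 | _ | n≡3k = ⊥-elim (3≢1 (cop (∣-refl , divides (n / 3) n≡3k)))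
  where
  3≢1 : 3 ≢ 1
  3≢1 ()
... | 1 | _ | n≡3k+1 = n / 3 , 1 , inj₁ refl , trans (residue-form (n / 3) 1) (sym n≡3k+1)
... | 2 | _ | n≡3k+2 = n / 3 , 2 , inj₂ refl , trans (residue-form (n / 3) 2) (sym n≡3k+2)
... | suc (suc (suc _)) | s≤s (s≤s (s≤s ())) | _

proposition7 :
    (∀ (k : ℕ) → ∃ λ (P : Poly) → IsC 3 (3 * k + 1) P
        × ((mono 2 ⊕ neg one) ⊗ P
           ≈ neg (sumTo k (λ i → mono ((3 * k + 1) ∸ (3 * i + 1))))
             ⊕ sumTo k (λ i → mono ((3 * k + 1) + (3 * i + 1)))))
    × (∀ (k : ℕ) → ∃ λ (P : Poly) → IsC 3 (3 * k + 2) P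
        × ((mono 2 ⊕ neg one) ⊗ P
           ≈ neg (sumTo k (λ i → mono ((3 * k + 2) ∸ (3 * i + 2))))
             ⊕ sumTo k (λ i → mono ((3 * k + 2) + (3 * i + 2)))))
    × (∀ (n : ℕ) → 1 ≤ n → Coprime 3 n →
        ∃ λ (P : Poly) → IsC 3 n P × ParityUnimodal P)
proposition7 = case₁ , case₂ , unimodal
  where
  case₁ : ∀ k → ∃ λ P → IsC 3 (3 * k + 1) P
                × ((mono 2 ⊕ neg one) ⊗ P ≈ neg (sumTo k (λ i → mono ((3 * k + 1) ∸ (3 * i + 1))))
                                           ⊕ sumTo k (λ i → mono ((3 * k + 1) + (3 * i + 1))))
  case₁ k = C₃ 1 k , C₃-isC (inj₁ refl) k , ≋⇒≈ (C₃-difference (inj₁ refl) k)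
  case₂ : ∀ k → ∃ λ P → IsC 3 (3 * k + 2) P
                × ((mono 2 ⊕ neg one) ⊗ P ≈ neg (sumTo k (λ i → mono ((3 * k + 2) ∸ (3 * i + 2))))
                                           ⊕ sumTo k (λ i → mono ((3 * k + 2) + (3 * i + 2))))
  case₂ k = C₃ 2 k , C₃-isC (inj₂ refl) k , ≋⇒≈ (C₃-difference (inj₂ refl) k)
  unimodal : ∀ n → 1 ≤ n → Coprime 3 n → ∃ λ P → IsC 3 n P × ParityUnimodal P
  unimodal n _ cop with coprime-to-3 n cop
  ... | k , c , r , refl = C₃ c k , C₃-isC r k , C₃-parityUnimodal r k
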